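{- Let $G=(V,E)$ be a popular roommates instance. Let $U\subseteq V$ be non-empty, $Z=V\setminus(N(U)\cup U)$, and let $P_Z$ be a matching of $G$ covering every vertex of $Z$ such that every edge of $P_Z$ has at least one end vertex in $Z$. Let $V'=Z\cup P_Z(Z)\cup U$, $G'=G[V']$ (preferences restricted), and let $D$ be the set of dangerous vertices (see context). Assume that $P_Z$ is popular in $G'$, that some edge of $G'$ blocks $P_Z$, and that there are no $z\in D$ and $x\in N(z)\cap(V\setminus V')$ with $x\succ_z P_Z(z)$. Let $H$ be the graph obtained from $G[V\setminus V']$ (with preferences restricted to the remaining edges) by deleting every edge $\{x,y\}$ of $G[V\setminus V']$ such that, for at least one of its two orientations $(x,y)$, one of the following holds: 1. there is $u\in U$ with $u\succ_x y$; 2. there is $z\in D$ with $z\succ_x y$; 3. there is $v\in V'\setminus(D\cup U)$ with $x\succ_v P_Z(v)$ and $v\succ_x y$. Then a matching $S$ of $G[V\setminus V']$ is stable in $G[V\setminus V']$, covers all vertices of $V\setminus V'$, and, with respect to $P=P_Z\cup S$, satisfies the labelling conditions (a) every edge incident to a vertex of $U$ is labelled $(+,-)$ with the $+$ at the vertex in $U$, (b) every edge between $D$ and $V\setminus V'$ is labelled $(-,-)$, (c) every edge $(v',x)$ with $v'\in V'\setminus(D\cup U)$, $x\in V\setminus V'$ and $x\succ_{v'}P(v')$ is labelled $(+,-)$ with the $+$ at $v'$, if and only if $S$ is a stable matching of $H$ that covers all vertices of $V\setminus V'$.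
   Context: A popular roommates instance is a simple graph $G=(V,E)$ in which every vertex $v$ has a strict preference order $\succ_v$ over its neighbours $N(v)$ (the graph need not be complete); $a\succ_x b$ is only meaningful for neighbours $a,b$ of $x$. For a matching $M$, $M(v)$ denotes the partner of $v$ in $M$, with $M(v)=v$ if $v$ is unmatched; every vertex prefers any neighbour to being unmatched. For $X\subseteq V$, $M(X)=\bigcup_{v\in X}M(v)$; $N(U)$ is the set of vertices adjacent to at least one vertex of $U$; $G[X]$ is the induced subgraph. A vertex $v$ prefers matching $M$ to $M'$ if $v$ is matched in $M$ and unmatched in $M'$, or matched in both and $M(v)\succ_v M'(v)$. $M$ is popular (in a given instance) if there is no matching $M'$ of that instance such that more vertices prefer $M'$ to $M$ than prefer $M$ to $M'$. An edge $(a,b)\notin M$ blocks $M$ if $b\succ_a M(a)$ and $a\succ_b M(b)$; $M$ is stable if no edge blocks it. Each edge $(u,v)\notin M$ gets the label $(\mathrm{vote}_u(v,M),\mathrm{vote}_v(u,M))$, where $\mathrm{vote}_u(v,M)=+$ (the "$+$ at $u$") if $v\succ_u M(u)$ and $-$ if $M(u)\succ_u v$. $G'_{M}$ is obtained from $G'$ by deleting all edges labelled $(-,-)$. An alternating path with respect to $M$ is a path whose edges alternate between edges not in $M$ and edges in $M$. The set $D$ of dangerous vertices consists of those vertices $z$ for which there is an alternating path with respect to $P_Z$ in $G'_{P_Z}$ that starts with an edge blocking $P_Z$ in $G'$ and traverses the matching edge $(P_Z(z),z)$ such that, counting from the blocking edge, $z$ is the further end of this matching edge. -}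

module Defs where

open import Data.Nat using (ℕ; zero; suc; _<_; _≤_; _<?_; _%_)
open import Data.Fin using (Fin; zero; suc; toℕ; inject₁; _≟_)
open import Data.List using (List; length; filter; allFin)
open import Data.Product using (_×_; _,_; Σ; ∃; ∃-syntax)
open import Data.Sum using (_⊎_; inj₁; inj₂)
open import Data.Bool using (if_then_else_)
open import Relation.Nullary using (¬_; Dec; yes; no; does)
open import Relation.Nullary.Decidable using (_×-dec_; _⊎-dec_; ¬?)
open import Relation.Binary.PropositionalEquality using (_≡_; _≢_)

-- Preferences: rank v a is the position of a in v's strict preference
-- list; a ≻_v b  iff  rank v a < rank v b.
-- Only comparisons between neighbours are ever used.

record Instance (n : ℕ) : Set₁ where
  field
    E       : Fin n → Fin n → Set
    E-sym   : ∀ {a b} → E a b → E b a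
    E-irr   : ∀ {a} → ¬ E a a
    rank    : Fin n → Fin n → ℕ
    rank-inj : ∀ {v a b} → E v a → E v b → rank v a ≡ rank v b → a ≡ b

-- Subsets of vertices are predicates; edge sets of subgraphs (of the
-- same vertex set Fin n) are relations.  A subgraph keeps the preference
-- ranks of G (preferences restricted).
VSet : ℕ → Set₁
VSet n = Fin n → Set

ESet : ℕ → Set₁
ESet n = Fin n → Fin n → Set

module _ {n : ℕ} (G : Instance n) where
  open Instance G

  _≻[_]_ : Fin n → Fin n → Fin n → Set
  a ≻[ v ] b = rank v a < rank v b

  -- Matchings as involutions; M v ≡ v means v is unmatched.
  IsMatching : ESet n → (Fin n → Fin n) → Set
  IsMatching F M = (∀ v → M (M v) ≡ v) × (∀ v → M v ≢ v → F v (M v))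

  Covers : (Fin n → Fin n) → VSet n → Set
  Covers M X = ∀ v → X v → M v ≢ v

  Prefers : (Fin n → Fin n) → (Fin n → Fin n) → Fin n → Set
  Prefers M M' v = (M v ≢ v × M' v ≡ v)
                 ⊎ (M v ≢ v × M' v ≢ v × (M v ≻[ v ] M' v))

  prefers? : (M M' : Fin n → Fin n) → (v : Fin n) → Dec (Prefers M M' v)
  prefers? M M' v =
    (¬? (M v ≟ v) ×-dec (M' v ≟ v))
    ⊎-dec (¬? (M v ≟ v) ×-dec (¬? (M' v ≟ v) ×-dec (rank v (M v) <? rank v (M' v))))

  #Prefer : (Fin n → Fin n) → (Fin n → Fin n) → ℕ
  #Prefer M M' = length (filter (prefers? M M') (allFin n))

  Popular : ESet n → (Fin n → Fin n) → Set
  Popular F M = IsMatching F M ×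
    (∀ M' → IsMatching F M' → #Prefer M' M ≤ #Prefer M M')

  -- vote_u(v, M) = +  :  v ≻_u M(u)  (any neighbour beats being unmatched)
  Plus : (Fin n → Fin n) → Fin n → Fin n → Set
  Plus M u v = M u ≡ u ⊎ (M u ≢ u × (v ≻[ u ] M u))

  Minus : (Fin n → Fin n) → Fin n → Fin n → Set
  Minus M u v = M u ≢ u × (M u ≻[ u ] v)

  Blocks : ESet n → (Fin n → Fin n) → Fin n → Fin n → Set
  Blocks F M a b = F a b × M a ≢ b × Plus M a b × Plus M b a

  Stable : ESet n → (Fin n → Fin n) → Set
  Stable F M = IsMatching F M × (∀ a b → ¬ Blocks F M a b)

  Induced : VSet n → ESet n
  Induced X a b = E a b × X a × X b

  -- union of two matchings with disjoint supports
  _∪M_ : (Fin n → Fin n) → (Fin n → Fin n) → Fin n → Fin n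
  (M₁ ∪M M₂) v = if does (M₁ v ≟ v) then M₂ v else M₁ v

  -- Alternating path w.r.t. M in F_M (F with (-,-)-edges deleted),
  -- starting with an edge of F blocking M, visiting vertices
  -- p 0, p 1, ..., p (k+1) (pairwise distinct); edge i joins p i, p (i+1);
  -- even-indexed edges are non-matching edges of F_M, odd-indexed ones
  -- are matching edges.
  record AltPath (F : ESet n) (M : Fin n → Fin n) : Set where
    field
      k     : ℕ
      p     : Fin (suc (suc k)) → Fin n
      p-inj : ∀ i j → p i ≡ p j → i ≡ j
      start : Blocks F M (p zero) (p (suc zero))
      even-edge : ∀ (i : Fin (suc k)) → toℕ i % 2 ≡ 0 →
                    F (p (inject₁ i)) (p (suc i)) × M (p (inject₁ i)) ≢ p (suc i)
                    × ¬ (Minus M (p (inject₁ i)) (p (suc i)) × Minus M (p (suc i)) (p (inject₁ i)))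
      odd-edge  : ∀ (i : Fin (suc k)) → toℕ i % 2 ≡ 1 →
                    M (p (inject₁ i)) ≡ p (suc i)

  Dangerous : ESet n → (Fin n → Fin n) → VSet n
  Dangerous F M z = Σ (AltPath F M) λ π → let open AltPath π in
    ∃[ j ] (toℕ j % 2 ≡ 1 × p (inject₁ j) ≡ M z × p (suc j) ≡ z)

  module Setup (U : VSet n) (PZ : Fin n → Fin n) where
    NU : VSet n
    NU v = ∃[ u ] (U u × E u v)

    Z : VSet n
    Z v = ¬ (NU v ⊎ U v)

    V' : VSet n
    V' v = Z v ⊎ (∃[ z ] (Z z × PZ z ≡ v)) ⊎ U v

    W : VSet n
    W v = ¬ V' v

    G' : ESet n
    G' = Induced V'

    GW : ESet n
    GW = Induced W

    D : VSet n
    D = Dangerous G' PZ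

    Del : Fin n → Fin n → Set
    Del x y = (∃[ u ] (U u × E x u × (u ≻[ x ] y)))
            ⊎ (∃[ z ] (D z × E x z × (z ≻[ x ] y)))
            ⊎ (∃[ v ] (V' v × ¬ D v × ¬ U v × E x v × Plus PZ v x × (v ≻[ x ] y)))

    H : ESet n
    H x y = GW x y × ¬ (Del x y ⊎ Del y x)

    -- labelling conditions (a), (b), (c) w.r.t. P; labels only concern
    -- edges not in P.
    LabelA : (Fin n → Fin n) → Set
    LabelA P = ∀ u w → U u → E u w → P u ≢ w → Plus P u w × Minus P w u

    LabelB : (Fin n → Fin n) → Set
    LabelB P = ∀ z x → D z → W x → E z x → P z ≢ x → Minus P z x × Minus P x z

    LabelC : (Fin n → Fin n) → Set
    LabelC P = ∀ v x → V' v → ¬ D v → ¬ U v → W x → E v x → P v ≢ x →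
               Plus P v x → Plus P v x × Minus P x v

{-# OPTIONS --safe #-}
-- Each rule deleting an orientation (x , y) names a vertex t ∈ V' with
-- t ≻_x y, and the labels say precisely that x votes − towards every such t;
-- on the V' side of the labels nothing depends on S: for U they follow from
-- popularity of P_Z in G', which forbids a neighbour of an unmatched vertex
-- to prefer it to its partner, and for D from the hypothesis on D.  So the
-- labels hold iff no edge of S is deleted, and a deleted edge (x , y) never
-- blocks S, since y ≻_x S(x) would give t ≻_x S(x) and delete S's own edge.
module Submission where

open import Defs
open import Data.Nat using (ℕ; _<_; _≤_; z≤n; s≤s)
open import Data.Nat.Properties using (<-cmp; <-asym; <-irrefl; <-trans; ≤-reflexive; m≤n⇒m≤1+n; module ≤-Reasoning)
open import Data.Fin using (Fin; _≟_)
open import Data.Product using (_×_; ∃; ∃-syntax; _,_; proj₁; proj₂)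
open import Data.Sum using (_⊎_; inj₁; inj₂)
open import Data.Empty using (⊥-elim)
open import Data.List using ([]; _∷_; length; filter; allFin)
open import Data.List.Properties using (filter-none)
open import Data.List.Relation.Unary.All as All using ()
open import Data.List.Relation.Unary.Any using (here; there)
open import Data.List.Relation.Unary.AllPairs using (_∷_)
open import Data.List.Relation.Unary.Unique.Propositional using (Unique)
open import Data.List.Relation.Unary.Unique.Propositional.Properties using (allFin⁺)
open import Data.List.Membership.Propositional using (_∈_)
open import Data.List.Membership.Propositional.Properties using (∈-allFin)
open import Relation.Nullary using (¬_; Dec; yes; no)
open import Relation.Unary using (Decidable)
open import Relation.Binary using (tri<; tri≈; tri>)
open import Relation.Binary.PropositionalEquality using (_≡_; _≢_; refl; sym; trans; cong; subst)
open import Function.Bundles using (_⇔_; mk⇔)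

module _ {a p} {A : Set a} {P : A → Set p} (P? : Decidable P) where

  length-filter≤1 : ∀ (z : A) xs → Unique xs → (∀ v → P v → v ≡ z) →
                    length (filter P? xs) ≤ 1
  length-filter≤1 z []       _              _    = z≤n
  length-filter≤1 z (x ∷ xs) (x∉xs ∷ uniq) only with P? x
  ... | yes Px = s≤s (≤-reflexive (cong length (filter-none P?
                   (All.map (λ {y} x≢y Py → x≢y (trans (only x Px) (sym (only y Py)))) x∉xs))))
  ... | no _   = length-filter≤1 z xs uniq only

  1≤length-filter : ∀ {y} xs → y ∈ xs → P y → 1 ≤ length (filter P? xs)
  1≤length-filter (x ∷ xs) y∈ Py with P? x | y∈
  ... | yes _  | _          = s≤s z≤n
  ... | no ¬Px | here refl  = ⊥-elim (¬Px Py)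
  ... | no _   | there y∈xs = 1≤length-filter xs y∈xs Py

  2≤length-filter : ∀ {y z} xs → y ∈ xs → z ∈ xs → y ≢ z → P y → P z →
                    2 ≤ length (filter P? xs)
  2≤length-filter (x ∷ xs) y∈ z∈ y≢z Py Pz with P? x | y∈ | z∈
  ... | _      | here refl  | here refl  = ⊥-elim (y≢z refl)
  ... | yes _  | here refl  | there z∈xs = s≤s (1≤length-filter xs z∈xs Pz)
  ... | yes _  | there y∈xs | here refl  = s≤s (1≤length-filter xs y∈xs Py)
  ... | yes _  | there y∈xs | there z∈xs = m≤n⇒m≤1+n (2≤length-filter xs y∈xs z∈xs y≢z Py Pz)
  ... | no ¬Px | here refl  | _          = ⊥-elim (¬Px Py)
  ... | no ¬Px | there _    | here refl  = ⊥-elim (¬Px Pz)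
  ... | no _   | there y∈xs | there z∈xs = 2≤length-filter xs y∈xs z∈xs y≢z Py Pz

-- M⁺ matches a with b, leaves the former partner of b unmatched and agrees
-- with M elsewhere; it is a matching when a is unmatched in M.
module Augment {n : ℕ} (M : Fin n → Fin n) (a b : Fin n) where

  data Place (v : Fin n) : Fin n → Set where
    at-a      : v ≡ a → Place v b
    at-b      : v ≢ a → v ≡ b → Place v a
    at-Mb     : v ≢ a → v ≢ b → M v ≡ b → Place v v
    elsewhere : v ≢ a → v ≢ b → M v ≢ b → Place v (M v)

  classify : ∀ {v} → Dec (v ≡ a) → Dec (v ≡ b) → Dec (M v ≡ b) → ∃ (Place v)
  classify (yes p) _       _       = _ , at-a p
  classify (no p)  (yes q) _       = _ , at-b p q
  classify (no p)  (no q)  (yes r) = _ , at-Mb p q r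
  classify (no p)  (no q)  (no r)  = _ , elsewhere p q r

  M⁺ : Fin n → Fin n
  M⁺ v = proj₁ (classify (v ≟ a) (v ≟ b) (M v ≟ b))

  place : ∀ v → Place v (M⁺ v)
  place v = proj₂ (classify (v ≟ a) (v ≟ b) (M v ≟ b))

  M⁺-a : M⁺ a ≡ b
  M⁺-a with M⁺ a | place a
  ... | _ | at-a _            = refl
  ... | _ | at-b a≢a _        = ⊥-elim (a≢a refl)
  ... | _ | at-Mb a≢a _ _     = ⊥-elim (a≢a refl)
  ... | _ | elsewhere a≢a _ _ = ⊥-elim (a≢a refl)

  M⁺-b : a ≢ b → M⁺ b ≡ a
  M⁺-b a≢b with M⁺ b | place b
  ... | _ | at-a b≡a          = ⊥-elim (a≢b (sym b≡a))
  ... | _ | at-b _ _          = refl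
  ... | _ | at-Mb _ b≢b _     = ⊥-elim (b≢b refl)
  ... | _ | elsewhere _ b≢b _ = ⊥-elim (b≢b refl)

  M⁺-Mb : ∀ {v} → v ≢ a → v ≢ b → M v ≡ b → M⁺ v ≡ v
  M⁺-Mb {v} v≢a v≢b Mv≡b with M⁺ v | place v
  ... | _ | at-a v≡a           = ⊥-elim (v≢a v≡a)
  ... | _ | at-b _ v≡b         = ⊥-elim (v≢b v≡b)
  ... | _ | at-Mb _ _ _        = refl
  ... | _ | elsewhere _ _ Mv≢b = ⊥-elim (Mv≢b Mv≡b)

  M⁺-elsewhere : ∀ {v} → v ≢ a → v ≢ b → M v ≢ b → M⁺ v ≡ M v
  M⁺-elsewhere {v} v≢a v≢b Mv≢b with M⁺ v | place v
  ... | _ | at-a v≡a        = ⊥-elim (v≢a v≡a)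
  ... | _ | at-b _ v≡b      = ⊥-elim (v≢b v≡b)
  ... | _ | at-Mb _ _ Mv≡b  = ⊥-elim (Mv≢b Mv≡b)
  ... | _ | elsewhere _ _ _ = refl

  module _ (M-inv : ∀ v → M (M v) ≡ v) (Ma≡a : M a ≡ a) (a≢b : a ≢ b) where

    M-≢a : ∀ {v} → v ≢ a → M v ≢ a
    M-≢a v≢a Mv≡a = v≢a (trans (sym (M-inv _)) (trans (cong M Mv≡a) Ma≡a))

    M⁺-inv : ∀ v → M⁺ (M⁺ v) ≡ v
    M⁺-inv v with M⁺ v | place v
    ... | _ | at-a refl               = M⁺-b a≢b
    ... | _ | at-b _ refl             = M⁺-a
    ... | _ | at-Mb v≢a v≢b Mv≡b      = M⁺-Mb v≢a v≢b Mv≡b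
    ... | _ | elsewhere v≢a v≢b Mv≢b  =
      trans (M⁺-elsewhere (M-≢a v≢a) Mv≢b (λ MMv≡b → v≢b (trans (sym (M-inv v)) MMv≡b)))
            (M-inv v)

module _ {n : ℕ} (G : Instance n) where
  open Instance G

  E⇒≢ : ∀ {a b} → E a b → a ≢ b
  E⇒≢ {a} Eab a≡b = E-irr (subst (E a) (sym a≡b) Eab)

  Plus-cong : ∀ {M M' v x} → M v ≡ M' v → Plus G M v x → Plus G M' v x
  Plus-cong {v = v} {x} = subst (λ t → t ≡ v ⊎ (t ≢ v × rank v x < rank v t))

  Minus-cong : ∀ {M M' v x} → M v ≡ M' v → Minus G M v x → Minus G M' v x
  Minus-cong {v = v} {x} = subst (λ t → t ≢ v × rank v t < rank v x)

  Minus⇒¬Plus : ∀ {M v x} → Minus G M v x → ¬ Plus G M v x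
  Minus⇒¬Plus (Mv≢v , _)  (inj₁ Mv≡v)     = Mv≢v Mv≡v
  Minus⇒¬Plus (_ , Mv≻x) (inj₂ (_ , x≻Mv)) = <-asym Mv≻x x≻Mv

  ¬Plus⇒Minus : ∀ {M v x} → (M v ≢ v → E v (M v)) → E v x → M v ≢ x →
                ¬ Plus G M v x → Minus G M v x
  ¬Plus⇒Minus {M} {v} {x} M-edge Evx Mv≢x ¬plus with M v ≟ v
  ... | yes Mv≡v = ⊥-elim (¬plus (inj₁ Mv≡v))
  ... | no Mv≢v with <-cmp (rank v (M v)) (rank v x)
  ...   | tri< Mv≻x _ _ = Mv≢v , Mv≻x
  ...   | tri≈ _ same _ = ⊥-elim (Mv≢x (rank-inj (M-edge Mv≢v) Evx same))
  ...   | tri> _ _ x≻Mv = ⊥-elim (¬plus (inj₂ (Mv≢v , x≻Mv)))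

  -- Otherwise matching a with b makes a and b better off and only the former
  -- partner of b worse off, so M would not be popular.
  unmatched-in-popular⇒¬Plus : ∀ {F M a b} → (∀ {x y} → F x y → F y x) →
    Popular G F M → F a b → a ≢ b → M a ≡ a → ¬ Plus G M b a
  unmatched-in-popular⇒¬Plus {F} {M} {a} {b} F-sym ((M-inv , M-edge) , popular) Fab a≢b Ma≡a b-wants-a =
    <-irrefl refl (begin
      2                 ≤⟨ 2≤length-filter (prefers? G M⁺ M) (allFin n) (∈-allFin a) (∈-allFin b)
                                           a≢b a-prefers-M⁺ (b-prefers-M⁺ b-wants-a) ⟩
      #Prefer G M⁺ M    ≤⟨ popular M⁺ (M⁺-inv M-inv Ma≡a a≢b , M⁺-edge) ⟩
      #Prefer G M M⁺    ≤⟨ length-filter≤1 (prefers? G M M⁺) (M b) (allFin n) (allFin⁺ n)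
                                           only-Mb-prefers-M ⟩
      1                 ∎)
    where
    open Augment M a b
    open ≤-Reasoning

    M⁺-edge : ∀ v → M⁺ v ≢ v → F v (M⁺ v)
    M⁺-edge v M⁺v≢v with M⁺ v | place v
    ... | _ | at-a refl       = Fab
    ... | _ | at-b _ refl     = F-sym Fab
    ... | _ | at-Mb _ _ _     = ⊥-elim (M⁺v≢v refl)
    ... | _ | elsewhere _ _ _ = M-edge v M⁺v≢v

    M⁺b≢b : M⁺ b ≢ b
    M⁺b≢b M⁺b≡b = a≢b (trans (sym (M⁺-b a≢b)) M⁺b≡b)

    a-prefers-M⁺ : Prefers G M⁺ M a
    a-prefers-M⁺ = inj₁ ((λ M⁺a≡a → a≢b (trans (sym M⁺a≡a) M⁺-a)) , Ma≡a)

    b-prefers-M⁺ : Plus G M b a → Prefers G M⁺ M b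
    b-prefers-M⁺ (inj₁ Mb≡b)          = inj₁ (M⁺b≢b , Mb≡b)
    b-prefers-M⁺ (inj₂ (Mb≢b , a≻Mb)) =
      inj₂ (M⁺b≢b , Mb≢b , subst (λ t → rank b t < rank b (M b)) (sym (M⁺-b a≢b)) a≻Mb)

    only-Mb-prefers-M : ∀ v → Prefers G M M⁺ v → v ≡ M b
    only-Mb-prefers-M v pref with M⁺ v | place v | pref
    ... | _ | at-a refl       | inj₁ (Ma≢a , _)     = ⊥-elim (Ma≢a Ma≡a)
    ... | _ | at-a refl       | inj₂ (Ma≢a , _)     = ⊥-elim (Ma≢a Ma≡a)
    ... | _ | at-b _ refl     | inj₁ (_ , a≡b)      = ⊥-elim (a≢b a≡b)
    ... | _ | at-b _ refl     | inj₂ (Mb≢b , _ , Mb≻a) = ⊥-elim (Minus⇒¬Plus {M} (Mb≢b , Mb≻a) b-wants-a)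
    ... | _ | at-Mb _ _ Mv≡b  | _                   = trans (sym (M-inv v)) (cong M Mv≡b)
    ... | _ | elsewhere _ _ _ | inj₁ (Mv≢v , Mv≡v)  = ⊥-elim (Mv≢v Mv≡v)
    ... | _ | elsewhere _ _ _ | inj₂ (_ , _ , Mv≻Mv) = ⊥-elim (<-irrefl refl Mv≻Mv)

module _ {n : ℕ} (G : Instance n) (U : VSet n) (PZ : Fin n → Fin n) where
  open Instance G
  open Setup G U PZ

  Del-downward-closed : ∀ {x y y'} → Del x y → rank x y < rank x y' → Del x y'
  Del-downward-closed (inj₁ (u , Uu , Exu , u≻y)) y≻y' =
    inj₁ (u , Uu , Exu , <-trans u≻y y≻y')
  Del-downward-closed (inj₂ (inj₁ (z , Dz , Exz , z≻y))) y≻y' =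
    inj₂ (inj₁ (z , Dz , Exz , <-trans z≻y y≻y'))
  Del-downward-closed (inj₂ (inj₂ (v , V'v , ¬Dv , ¬Uv , Exv , v-wants-x , v≻y))) y≻y' =
    inj₂ (inj₂ (v , V'v , ¬Dv , ¬Uv , Exv , v-wants-x , <-trans v≻y y≻y'))

  V'-W-disjoint : ∀ {v x} → V' v → W x → v ≢ x
  V'-W-disjoint V'v Wx v≡x = Wx (subst V' v≡x V'v)

  U⊆V' : ∀ {u} → U u → V' u
  U⊆V' Uu = inj₂ (inj₂ Uu)

  module Decomposition (PZ-matching : IsMatching G E PZ)
                       (PZ-edge-meets-Z : ∀ v → PZ v ≢ v → Z v ⊎ Z (PZ v))
                       (S : Fin n → Fin n) (S-matching : IsMatching G GW S) where

    P : Fin n → Fin n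
    P = _∪M_ G PZ S

    PZ-matched⇒V' : ∀ {v} → PZ v ≢ v → V' v × V' (PZ v)
    PZ-matched⇒V' {v} PZv≢v with PZ-edge-meets-Z v PZv≢v
    ... | inj₁ Zv   = inj₁ Zv , inj₂ (inj₁ (v , Zv , refl))
    ... | inj₂ ZPZv = inj₂ (inj₁ (PZ v , ZPZv , proj₁ PZ-matching v)) , inj₁ ZPZv

    S-matched⇒W : ∀ {v} → S v ≢ v → W v × W (S v)
    S-matched⇒W {v} Sv≢v = let (_ , Wv , WSv) = proj₂ S-matching v Sv≢v in Wv , WSv

    P-on-V' : ∀ {v} → V' v → P v ≡ PZ v
    P-on-V' {v} V'v with PZ v ≟ v
    ... | no _ = refl
    ... | yes PZv≡v with S v ≟ v
    ...   | yes Sv≡v = trans Sv≡v (sym PZv≡v)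
    ...   | no Sv≢v  = ⊥-elim (proj₁ (S-matched⇒W Sv≢v) V'v)

    P-on-W : ∀ {x} → W x → P x ≡ S x
    P-on-W {x} Wx with PZ x ≟ x
    ... | yes _     = refl
    ... | no PZx≢x  = ⊥-elim (Wx (proj₁ (PZ-matched⇒V' PZx≢x)))

    PZ-maps-V' : ∀ {v} → V' v → V' (PZ v)
    PZ-maps-V' {v} V'v with PZ v ≟ v
    ... | yes PZv≡v = subst V' (sym PZv≡v) V'v
    ... | no PZv≢v  = proj₂ (PZ-matched⇒V' PZv≢v)

    P-V'-avoids-W : ∀ {v x} → V' v → W x → P v ≢ x
    P-V'-avoids-W V'v Wx Pv≡x = V'-W-disjoint (PZ-maps-V' V'v) Wx (trans (sym (P-on-V' V'v)) Pv≡x)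

    S-avoids-V' : ∀ {x t} → S x ≢ x → V' t → S x ≢ t
    S-avoids-V' Sx≢x V't Sx≡t = V'-W-disjoint V't (proj₂ (S-matched⇒W Sx≢x)) (sym Sx≡t)

    U-unmatched : ∀ {u} → U u → PZ u ≡ u
    U-unmatched {u} Uu with PZ u ≟ u
    ... | yes PZu≡u = PZu≡u
    ... | no PZu≢u with PZ-edge-meets-Z u PZu≢u
    ...   | inj₁ Zu   = ⊥-elim (Zu (inj₂ Uu))
    ...   | inj₂ ZPZu = ⊥-elim (ZPZu (inj₁ (u , Uu , proj₂ PZ-matching u PZu≢u)))

    module Reduction (D-no-outside-Plus : ∀ z x → D z → E z x → W x → ¬ Plus G PZ z x) where

      D⇒V' : ∀ {z x} → D z → E z x → W x → V' z
      D⇒V' Dz Ezx Wx = proj₁ (PZ-matched⇒V' (λ PZz≡z → D-no-outside-Plus _ _ Dz Ezx Wx (inj₁ PZz≡z)))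

      labels⇒H-stable : Stable G GW S → Covers G S W →
                         LabelA P → LabelB P → LabelC P → Stable G H S
      labels⇒H-stable (_ , GW-stable) S-covers labelA labelB labelC =
        (proj₁ S-matching , λ v Sv≢v → proj₂ S-matching v Sv≢v , partner-edge-kept v Sv≢v) ,
        λ a b ((GWab , _) , rest) → GW-stable a b (GWab , rest)
        where
        not-preferred : ∀ {x t} → W x → Minus G P x t → ¬ rank x t < rank x (S x)
        not-preferred {x} Wx minus t≻Sx =
          Minus⇒¬Plus G {S} (Minus-cong G {P} {S} (P-on-W Wx) minus) (inj₂ (S-covers x Wx , t≻Sx))

        labels-forbid-Del-partner : ∀ {x} → W x → ¬ Del x (S x)
        labels-forbid-Del-partner Wx (inj₁ (u , Uu , Exu , u≻Sx)) =
          not-preferred Wx (proj₂ (labelA u _ Uu (E-sym Exu) (P-V'-avoids-W (U⊆V' Uu) Wx))) u≻Sx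
        labels-forbid-Del-partner Wx (inj₂ (inj₁ (z , Dz , Exz , z≻Sx))) =
          not-preferred Wx (proj₂ (labelB z _ Dz Wx (E-sym Exz)
                                    (P-V'-avoids-W (D⇒V' Dz (E-sym Exz) Wx) Wx))) z≻Sx
        labels-forbid-Del-partner Wx (inj₂ (inj₂ (v , V'v , ¬Dv , ¬Uv , Exv , v-wants-x , v≻Sx))) =
          not-preferred Wx (proj₂ (labelC v _ V'v ¬Dv ¬Uv Wx (E-sym Exv) (P-V'-avoids-W V'v Wx)
                                    (Plus-cong G {PZ} {P} (sym (P-on-V' V'v)) v-wants-x))) v≻Sx

        partner-edge-kept : ∀ v → S v ≢ v → ¬ (Del v (S v) ⊎ Del (S v) v)
        partner-edge-kept v Sv≢v (inj₁ del) = labels-forbid-Del-partner (proj₁ (S-matched⇒W Sv≢v)) del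
        partner-edge-kept v Sv≢v (inj₂ del) =
          labels-forbid-Del-partner (proj₂ (S-matched⇒W Sv≢v)) (subst (Del (S v)) (sym (proj₁ S-matching v)) del)

      module _ (popular : Popular G G' PZ) (H-stable : Stable G H S) (S-covers : Covers G S W) where

        ¬Del-partner : ∀ {x} → S x ≢ x → ¬ Del x (S x)
        ¬Del-partner {x} Sx≢x del = proj₂ (proj₂ (proj₁ H-stable) x Sx≢x) (inj₁ del)

        Plus⇒¬Del : ∀ {x y} → W x → Plus G S x y → ¬ Del x y
        Plus⇒¬Del {x} Wx (inj₁ Sx≡x)          _   = S-covers x Wx Sx≡x
        Plus⇒¬Del     Wx (inj₂ (Sx≢x , y≻Sx)) del = ¬Del-partner Sx≢x (Del-downward-closed del y≻Sx)

        GW-stable : Stable G GW S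
        GW-stable = S-matching , λ a b (GWab@(_ , Wa , Wb) , rest@(_ , a-wants-b , b-wants-a)) →
          proj₂ H-stable a b
            ((GWab , λ { (inj₁ del) → Plus⇒¬Del Wa a-wants-b del
                       ; (inj₂ del) → Plus⇒¬Del Wb b-wants-a del }) , rest)

        Minus-toward-deleter : ∀ {x t} → W x → E x t → V' t →
                               (rank x t < rank x (S x) → Del x (S x)) → Minus G P x t
        Minus-toward-deleter {x} {t} Wx Ext V't deletes =
          Minus-cong G {S} {P} (sym (P-on-W Wx))
            (¬Plus⇒Minus G {S} (λ Sx≢x → proj₁ (proj₂ S-matching x Sx≢x)) Ext
                         (S-avoids-V' (S-covers x Wx) V't)
                         (λ t-wanted → ¬Del-partner (S-covers x Wx) (deletes (t≻Sx t-wanted))))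
          where
          t≻Sx : Plus G S x t → rank x t < rank x (S x)
          t≻Sx (inj₁ Sx≡x)     = ⊥-elim (S-covers x Wx Sx≡x)
          t≻Sx (inj₂ (_ , lt)) = lt

        labelA : LabelA P
        labelA u w Uu Euw _ = inj₁ (trans (P-on-V' (U⊆V' Uu)) (U-unmatched Uu)) , w-Minus (PZ w ≟ w)
          where
          w-¬Plus : V' w → ¬ Plus G PZ w u
          w-¬Plus V'w = unmatched-in-popular⇒¬Plus G (λ (e , a , b) → E-sym e , b , a) popular
                          (Euw , U⊆V' Uu , V'w) (E⇒≢ G Euw) (U-unmatched Uu)

          PZw≢u : PZ w ≢ u
          PZw≢u PZw≡u = E⇒≢ G Euw
            (trans (sym (U-unmatched Uu)) (trans (cong PZ (sym PZw≡u)) (proj₁ PZ-matching w)))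

          w-Minus : Dec (PZ w ≡ w) → Minus G P w u
          w-Minus (no PZw≢w) = let V'w = proj₁ (PZ-matched⇒V' PZw≢w) in
            Minus-cong G {PZ} {P} (sym (P-on-V' V'w))
              (¬Plus⇒Minus G {PZ} (proj₂ PZ-matching w) (E-sym Euw) PZw≢u (w-¬Plus V'w))
          w-Minus (yes PZw≡w) =
            Minus-toward-deleter (λ V'w → w-¬Plus V'w (inj₁ PZw≡w)) (E-sym Euw) (U⊆V' Uu)
              (λ u≻Sw → inj₁ (u , Uu , E-sym Euw , u≻Sw))

        labelB : LabelB P
        labelB z x Dz Wx Ezx _ =
          Minus-cong G {PZ} {P} (sym (P-on-V' V'z))
            (¬Plus⇒Minus G {PZ} (proj₂ PZ-matching z) Ezx
                         (λ PZz≡x → V'-W-disjoint (PZ-maps-V' V'z) Wx PZz≡x)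
                         (D-no-outside-Plus z x Dz Ezx Wx)) ,
          Minus-toward-deleter Wx (E-sym Ezx) V'z (λ z≻Sx → inj₂ (inj₁ (z , Dz , E-sym Ezx , z≻Sx)))
          where
          V'z : V' z
          V'z = D⇒V' Dz Ezx Wx

        labelC : LabelC P
        labelC v x V'v ¬Dv ¬Uv Wx Evx _ v-wants-x =
          v-wants-x ,
          Minus-toward-deleter Wx (E-sym Evx) V'v
            (λ v≻Sx → inj₂ (inj₂ (v , V'v , ¬Dv , ¬Uv , E-sym Evx ,
                                  Plus-cong G {P} {PZ} (P-on-V' V'v) v-wants-x , v≻Sx)))

      H-stable⇒labels : Popular G G' PZ → Stable G H S → Covers G S W →
                        Stable G GW S × LabelA P × LabelB P × LabelC P
      H-stable⇒labels popular H-stable S-covers =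
        GW-stable popular H-stable S-covers , labelA popular H-stable S-covers ,
        labelB popular H-stable S-covers , labelC popular H-stable S-covers

claim4 : ∀ {n} (G : Instance n) (U : VSet n) (PZ : Fin n → Fin n) →
    let open Instance G
        open Setup G U PZ
    in
    (∃[ u ] U u) →
    IsMatching G E PZ →
    Covers G PZ Z →
    (∀ v → PZ v ≢ v → Z v ⊎ Z (PZ v)) →
    Popular G G' PZ →
    (∃[ a ] ∃[ b ] Blocks G G' PZ a b) →
    (∀ z x → D z → E z x → W x → ¬ Plus G PZ z x) →
    (S : Fin n → Fin n) → IsMatching G GW S →
    ((Stable G GW S × Covers G S W
       × LabelA (_∪M_ G PZ S) × LabelB (_∪M_ G PZ S) × LabelC (_∪M_ G PZ S))
     ⇔ (Stable G H S × Covers G S W))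
claim4 G U PZ _ PZ-matching _ PZ-edge-meets-Z popular _ D-no-outside-Plus S S-matching =
  mk⇔ (λ (GW-stable , S-covers , labelA , labelB , labelC) →
         labels⇒H-stable GW-stable S-covers labelA labelB labelC , S-covers)
      (λ (H-stable , S-covers) →
         let (GW-stable , labels) = H-stable⇒labels popular H-stable S-covers
         in GW-stable , S-covers , labels)
  where
  open Decomposition G U PZ PZ-matching PZ-edge-meets-Z S S-matching
  open Reduction D-no-outside-Plus
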